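{- Let $M_{ -1},M_0,M_{+1}\in(\mathbb{Q}\cup\{ -\infty\})^{n\times n}$, let $G$ be the associated static graph (with $n$ nodes) and $G_{\mathbb{N}}$ the induced $\mathbb{N}$-periodic graph. Then $G_{\mathbb{N}}$ contains an $\infty$-weight path if and only if $G$ contains either (i) a circuit with length at most $n$, positive weight, and zero shift, or (ii) a path $p=q_1p'q_2$ (concatenation), where $\mathrm{len}(p')<n$, $\mathrm{len}(q_1)\le n$, $\mathrm{len}(q_2)\le n$, and $q_1,q_2$ are circuits with shifts $s_1,s_2$ and weights $w_1,w_2$ respectively satisfying $s_1>0$, $s_2<0$, and $-s_2w_1+s_1w_2>0$.
   Context: Static graph: given $M_{ -1},M_0,M_{+1}\in(\mathbb{Q}\cup\{ -\infty\})^{n\times n}$, the static graph $G=G(M_{ -1},M_0,M_{+1})$ is the weighted directed multigraph with node set $\{1,\dots,n\}$ and arc set $E\subseteq\{1,\dots,n\}^2\times\{ -1,0,+1\}$, where there is an arc $(i,j,s)$ from $i$ to $j$ with shift $s$ and weight $(M_s)_{ji}$ if and only if $(M_s)_{ji}\neq-\infty$. $\mathbb{N}$-periodic graph: $G_{\mathbb{N}}$ has node set $\{1,\dots,n\}\times\mathbb{N}$ and an arc $((i,k),(j,k+s))$ of weight $(M_s)_{ji}$ for every arc $(i,j,s)\in E$ and every $k$ with $k,k+s\in\mathbb{N}$ ($\mathbb{N}=\{1,2,\dots\}$). A path $(v_1,e_1,\dots,v_m)$ is an alternating sequence of nodes and arcs with $e_i$ going from $v_i$ to $v_{i+1}$;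 its length is $m-1$, its shift is the sum of the shifts of its arcs, its weight is the sum of the weights of its arcs; it is a circuit if $v_1=v_m$. Concatenation $p_1p_2$ of paths with $\mathrm{target}(p_1)=\mathrm{source}(p_2)$ is the obvious joined path. $G_{\mathbb{N}}$ contains an $\infty$-weight path if there are nodes $u,v$ of $G_{\mathbb{N}}$ and an infinite sequence of paths $p_1,p_2,\dots$ from $u$ to $v$ with strictly increasing weights. -}

module Defs where

open import Data.Nat as ℕ using (ℕ; zero; suc)
open import Data.Integer as ℤ using (ℤ; +_; -[1+_])
open import Data.Rational as ℚ using (ℚ)
open import Data.Fin using (Fin)
open import Data.Maybe using (Maybe; just; nothing)
open import Data.Product using (_×_; Σ)
open import Relation.Binary.PropositionalEquality using (_≡_)

data Shift : Set where
  minus zero plus : Shift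

shiftℤ : Shift → ℤ
shiftℤ minus = -[1+ 0 ]
shiftℤ zero  = + 0
shiftℤ plus  = + 1

-- Entries of Q ∪ {-∞}: nothing = -∞, just q = q.
ℚ∞ : Set
ℚ∞ = Maybe ℚ

-- The triple of matrices (M_{-1}, M_0, M_{+1}) indexed by shift;
-- M s j i = (M_s)_{ji}.
Mats : ℕ → Set
Mats n = Shift → Fin n → Fin n → ℚ∞

-- Static graph G = G(M_{-1},M_0,M_{+1}): node set Fin n, an arc (i,j,s)
-- from i to j with shift s and weight w = (M_s)_{ji} iff (M_s)_{ji} ≠ -∞.

data Path {n : ℕ} (M : Mats n) : Fin n → Fin n → Set where
  []   : ∀ {i} → Path M i i
  step : ∀ {i j k} (s : Shift) (w : ℚ) → M s j i ≡ just w →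
         Path M j k → Path M i k

module _ {n : ℕ} {M : Mats n} where

  len : ∀ {i j} → Path M i j → ℕ
  len []               = 0
  len (step _ _ _ p)   = suc (len p)

  shift : ∀ {i j} → Path M i j → ℤ
  shift []             = + 0
  shift (step s _ _ p) = shiftℤ s ℤ.+ shift p

  weight : ∀ {i j} → Path M i j → ℚ
  weight []             = ℚ.0ℚ
  weight (step _ w _ p) = w ℚ.+ weight p

  _++_ : ∀ {i j k} → Path M i j → Path M j k → Path M i k
  []             ++ q = q
  step s w e p   ++ q = step s w e (p ++ q)

-- N-periodic graph G_N: node set Fin n × N with N = {1,2,...}; for each arc
-- (i,j,s) of G and each level k with k, k+s ∈ N an arc (i,k) → (j,k+s)
-- of weight (M_s)_{ji}. Levels are represented by natural numbers ≥ 1.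

data Move : Shift → ℕ → ℕ → Set where
  down : ∀ {k} → Move minus (suc (suc k)) (suc k)
  stay : ∀ {k} → Move zero  (suc k) (suc k)
  up   : ∀ {k} → Move plus  (suc k) (suc (suc k))

data PathN {n : ℕ} (M : Mats n) : Fin n → ℕ → Fin n → ℕ → Set where
  []   : ∀ {i k} → PathN M i k i k
  step : ∀ {i j m k k' l} (s : Shift) (w : ℚ) → M s j i ≡ just w →
         Move s k k' → PathN M j k' m l → PathN M i k m l

weightN : ∀ {n} {M : Mats n} {i k j l} → PathN M i k j l → ℚ
weightN []                 = ℚ.0ℚ
weightN (step _ w _ _ p)   = w ℚ.+ weightN p

NodeN : ℕ → Set
NodeN n = Fin n × ℕ

HasInfWeightPath : ∀ {n} → Mats n → Set
HasInfWeightPath {n} M =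
  Σ (Fin n) λ i → Σ ℕ λ k → Σ (Fin n) λ j → Σ ℕ λ l →
    (1 ℕ.≤ k) × (1 ℕ.≤ l) ×
    (Σ (ℕ → PathN M i k j l) λ p →
       ∀ m → weightN (p m) ℚ.< weightN (p (suc m)))

ℤ→ℚ : ℤ → ℚ
ℤ→ℚ z = z ℚ./ 1

CondI : ∀ {n} → Mats n → Set
CondI {n} M =
  Σ (Fin n) λ a → Σ (Path M a a) λ c →
    (len c ℕ.≤ n) × (ℚ.0ℚ ℚ.< weight c) × (shift c ≡ + 0)

CondII : ∀ {n} → Mats n → Set
CondII {n} M =
  Σ (Fin n) λ a → Σ (Fin n) λ b →
  Σ (Path M a a) λ q₁ → Σ (Path M a b) λ p' → Σ (Path M b b) λ q₂ →
  Σ (Path M a b) λ p → (p ≡ q₁ ++ (p' ++ q₂)) ×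
    (len p' ℕ.< n) × (len q₁ ℕ.≤ n) × (len q₂ ℕ.≤ n) ×
    (+ 0 ℤ.< shift q₁) × (shift q₂ ℤ.< + 0) ×
    (ℚ.0ℚ ℚ.< (ℚ.- (ℤ→ℚ (shift q₂)) ℚ.* weight q₁
               ℚ.+ ℤ→ℚ (shift q₁) ℚ.* weight q₂))

module Submission where

-- Above level n every short path of G lifts to G_N. So a zero-shift
-- circuit of positive weight can be repeated in place, and in case (ii) one
-- climbs m·s₂ times around q₁, crosses along p' and descends m·s₁ times
-- around q₂: the end levels stay fixed while the weight grows by
-- m (-s₂ w₁ + s₁ w₂).
--
-- Conversely, if neither condition holds let r(y) be the largest ratio
-- w(C)/s(C) over short circuits C of positive shift from which y is
-- reachable. Then r increases along arcs and every short circuit C at b has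
-- w(C) ≤ r(b) s(C) (for s(C) = 0 by ¬(i), for s(C) < 0 by ¬(ii)). Removing
-- circuits one at a time bounds the weight of every path of G_N from (i,k)
-- to (j,l) by a constant plus r(j)(l-1) - r(i)(k-1), and since all weights
-- lie in (1/D)ℤ for a common denominator D, no strictly increasing sequence
-- of them stays below that bound. Both conditions only involve paths of
-- length ≤ n, so they are decidable and the case split is constructive.

open import Defs
open import Data.Nat using (ℕ)
open import Data.Sum using (_⊎_)
open import Function.Bundles using (_⇔_)

open import Data.Nat as ℕ using (zero; suc; s≤s; z≤n)
import Data.Nat.Properties as ℕP
open import Data.Nat.Divisibility using (divides)
open import Data.Nat.ListAction using (product)
open import Data.Nat.ListAction.Properties using (∈⇒∣product; product≢0)
import Data.Nat.Coprimality as Coprime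
open import Data.Integer as ℤ using (ℤ; +_; -[1+_])
import Data.Integer.Properties as ℤP
import Data.Integer.Solver as ℤSolver
open import Data.Rational as ℚ using (ℚ; mkℚ; 0ℚ; 1ℚ)
import Data.Rational.Properties as ℚP
import Data.Rational.Solver as ℚSolver
import Data.Rational.Unnormalised as ℚᵘ
import Data.Rational.Unnormalised.Properties as ℚᵘP
open import Algebra.Properties.Monoid.Mult ℚP.+-0-monoid using (×-homo-+) renaming (_×_ to _·_)
open import Data.Fin as Fin using (Fin; toℕ; inject≤)
import Data.Fin.Properties as FinP
open import Data.Maybe using (Maybe; just; nothing)
import Data.Maybe.Properties as MaybeP
open import Data.Product using (Σ; ∃; _×_; _,_; proj₁; proj₂)
open import Data.Sum using (inj₁; inj₂; [_,_]′)
open import Data.Empty using (⊥-elim)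
open import Data.List using (List; []; _∷_; map; concatMap; allFin; fromMaybe)
import Data.List.Relation.Unary.All as All
import Data.List.Relation.Unary.All.Properties as All
import Data.List.Relation.Unary.Any as Any
open import Data.List.Membership.Propositional using (_∈_; lose)
import Data.List.Membership.Propositional.Properties as ∈P
open import Relation.Binary.Bundles using (DecTotalOrder)
open import Data.List.Extrema (DecTotalOrder.totalOrder ℚP.≤-decTotalOrder) using (max; xs≤max; v≤max⁺; argmax-all)
open import Relation.Binary.PropositionalEquality
open import Relation.Nullary using (¬_; Dec; yes; no)
import Relation.Nullary.Decidable as Dec
open import Relation.Nullary.Decidable using (_×-dec_)
open import Axiom.UniquenessOfIdentityProofs using (module Decidable⇒UIP)
open Function.Bundles using (mk⇔)

ℤ→ℚ≡mkℚ : ∀ z → ℤ→ℚ z ≡ mkℚ z 0 (Coprime.sym (Coprime.1-coprimeTo ℤ.∣ z ∣))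
ℤ→ℚ≡mkℚ z = ℚP.toℚᵘ-injective (ℚP.toℚᵘ-fromℚᵘ (ℚᵘ.mkℚᵘ z 0))

ℤ→ℚ-mono-≤ : ∀ {a b} → a ℤ.≤ b → ℤ→ℚ a ℚ.≤ ℤ→ℚ b
ℤ→ℚ-mono-≤ {a} {b} a≤b rewrite ℤ→ℚ≡mkℚ a | ℤ→ℚ≡mkℚ b =
  ℚ.*≤* (subst₂ ℤ._≤_ (sym (ℤP.*-identityʳ a)) (sym (ℤP.*-identityʳ b)) a≤b)

ℤ→ℚ-mono-< : ∀ {a b} → a ℤ.< b → ℤ→ℚ a ℚ.< ℤ→ℚ b
ℤ→ℚ-mono-< {a} {b} a<b rewrite ℤ→ℚ≡mkℚ a | ℤ→ℚ≡mkℚ b =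
  ℚ.*<* (subst₂ ℤ._<_ (sym (ℤP.*-identityʳ a)) (sym (ℤP.*-identityʳ b)) a<b)

ℤ→ℚ-cancel-< : ∀ {a b} → ℤ→ℚ a ℚ.< ℤ→ℚ b → a ℤ.< b
ℤ→ℚ-cancel-< {a} {b} p rewrite ℤ→ℚ≡mkℚ a | ℤ→ℚ≡mkℚ b with p
... | ℚ.*<* q = subst₂ ℤ._<_ (ℤP.*-identityʳ a) (ℤP.*-identityʳ b) q

toℚᵘ-ℤ→ℚ : ∀ z → ℚ.toℚᵘ (ℤ→ℚ z) ℚᵘ.≃ ℚᵘ.mkℚᵘ z 0
toℚᵘ-ℤ→ℚ z = ℚP.toℚᵘ-fromℚᵘ (ℚᵘ.mkℚᵘ z 0)

ℤ→ℚ-homo-+ : ∀ a b → ℤ→ℚ (a ℤ.+ b) ≡ ℤ→ℚ a ℚ.+ ℤ→ℚ b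
ℤ→ℚ-homo-+ a b = ℚP.toℚᵘ-injective (ℚᵘP.≃-trans (toℚᵘ-ℤ→ℚ (a ℤ.+ b)) (ℚᵘP.≃-sym
  (ℚᵘP.≃-trans (ℚP.toℚᵘ-homo-+ (ℤ→ℚ a) (ℤ→ℚ b))
  (ℚᵘP.≃-trans (ℚᵘP.+-cong (toℚᵘ-ℤ→ℚ a) (toℚᵘ-ℤ→ℚ b))
  (ℚᵘ.*≡* (cong (ℤ._* + 1) (cong₂ ℤ._+_ (ℤP.*-identityʳ a) (ℤP.*-identityʳ b))))))))

ℤ→ℚ-homo‿- : ∀ a → ℤ→ℚ (ℤ.- a) ≡ ℚ.- ℤ→ℚ a
ℤ→ℚ-homo‿- a = ℚP.toℚᵘ-injective (ℚᵘP.≃-trans (toℚᵘ-ℤ→ℚ (ℤ.- a)) (ℚᵘP.≃-sym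
  (ℚᵘP.≃-trans (ℚP.toℚᵘ-homo‿- (ℤ→ℚ a))
  (ℚᵘP.≃-trans (ℚᵘP.-‿cong (toℚᵘ-ℤ→ℚ a)) (ℚᵘ.*≡* refl)))))

·≡ℤ→ℚ-* : ∀ k q → k · q ≡ ℤ→ℚ (+ k) ℚ.* q
·≡ℤ→ℚ-* zero    q = sym (ℚP.*-zeroˡ q)
·≡ℤ→ℚ-* (suc k) q = begin
  q ℚ.+ k · q                        ≡⟨ cong (q ℚ.+_) (·≡ℤ→ℚ-* k q) ⟩
  q ℚ.+ ℤ→ℚ (+ k) ℚ.* q              ≡⟨ solve 2 (λ q x → q :+ x :* q := (con 1ℚ :+ x) :* q) refl q (ℤ→ℚ (+ k)) ⟩
  (1ℚ ℚ.+ ℤ→ℚ (+ k)) ℚ.* q           ≡⟨ cong (ℚ._* q) (sym (ℤ→ℚ-homo-+ (+ 1) (+ k))) ⟩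
  ℤ→ℚ (+ suc k) ℚ.* q                ∎
  where open ≡-Reasoning
        open ℚSolver.+-*-Solver

-- Paths of G and their lifts to G_N

module _ {n : ℕ} {M : Mats n} where

  len-++ : ∀ {i j k} (p : Path M i j) (q : Path M j k) → len (p ++ q) ≡ len p ℕ.+ len q
  len-++ []             q = refl
  len-++ (step s w e p) q = cong suc (len-++ p q)

  weight-++ : ∀ {i j k} (p : Path M i j) (q : Path M j k) → weight (p ++ q) ≡ weight p ℚ.+ weight q
  weight-++ []             q = sym (ℚP.+-identityˡ _)
  weight-++ (step s w e p) q = trans (cong (w ℚ.+_) (weight-++ p q)) (sym (ℚP.+-assoc w _ _))

  -- Keeping the weight in the type makes transport along equal levels weight-preserving.
  PathNOf : Fin n → ℕ → Fin n → ℕ → ℚ → Set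
  PathNOf i k j l w = Σ (PathN M i k j l) λ P → weightN P ≡ w

  _++ᴺ_ : ∀ {i k j l m h v w} → PathNOf i k j l v → PathNOf j l m h w → PathNOf i k m h (v ℚ.+ w)
  ([] , refl) ++ᴺ (Q , refl) = Q , sym (ℚP.+-identityˡ _)
  (step s u e mv P , refl) ++ᴺ Q with (P , refl) ++ᴺ Q
  ... | PQ , wPQ = step s u e mv PQ , trans (cong (u ℚ.+_) wPQ) (sym (ℚP.+-assoc u _ _))

  project : ∀ {x h y l} → PathN M x h y l → Path M x y
  project []                = []
  project (step s w e _ P) = step s w e (project P)

  weightN≡weight∘project : ∀ {x h y l} (P : PathN M x h y l) → weightN P ≡ weight (project P)
  weightN≡weight∘project []                = refl
  weightN≡weight∘project (step s w e _ P) = cong (w ℚ.+_) (weightN≡weight∘project P)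

  cast-start : ∀ {i k k' j l w} → k ≡ k' → PathNOf i k j l w → PathNOf i k' j l w
  cast-start refl P = P

  cast-end : ∀ {i k j l l' w} → l ≡ l' → PathNOf i k j l w → PathNOf i k j l' w
  cast-end refl P = P

  record Lifting {a b} (p : Path M a b) (h : ℕ) : Set where
    constructor lifting
    field
      end       : ℕ
      end-shift : + end ≡ + h ℤ.+ shift p
      end-bound : h ℕ.≤ end ℕ.+ len p
      path      : PathNOf a h b end (weight p)

  -- Starting above level len p, no prefix of the lift can leave the levels ≥ 1.
  lift : ∀ {a b} (p : Path M a b) {h} → len p ℕ.< h → Lifting p h
  lift [] {h} _ = lifting h (sym (ℤP.+-identityʳ _)) (ℕP.≤-reflexive (sym (ℕP.+-identityʳ h))) ([] , refl)
  lift (step minus w e p) {suc (suc h)} (s≤s (s≤s lt)) with lift p {suc h} (s≤s lt)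
  ... | lifting h' eq bound (P , wP) = lifting h'
        (trans eq (ℤP.+-assoc (+ suc (suc h)) -[1+ 0 ] (shift p)))
        (subst (suc (suc h) ℕ.≤_) (sym (ℕP.+-suc h' (len p))) (s≤s bound))
        (step minus w e down P , cong (w ℚ.+_) wP)
  lift (step zero w e p) {suc h} (s≤s lt) with lift p {suc h} (ℕP.m≤n⇒m≤1+n lt)
  ... | lifting h' eq bound (P , wP) = lifting h'
        (trans eq (cong (λ x → + suc h ℤ.+ x) (sym (ℤP.+-identityˡ (shift p)))))
        (subst (suc h ℕ.≤_) (sym (ℕP.+-suc h' (len p))) (ℕP.m≤n⇒m≤1+n bound))
        (step zero w e stay P , cong (w ℚ.+_) wP)
  lift (step plus w e p) {suc h} (s≤s lt) with lift p {suc (suc h)} (ℕP.m≤n⇒m≤1+n (ℕP.m≤n⇒m≤1+n lt))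
  ... | lifting h' eq bound (P , wP) = lifting h'
        (trans eq (trans (cong (λ x → + x ℤ.+ shift p) (ℕP.+-comm 1 (suc h))) (ℤP.+-assoc (+ suc h) (+ 1) (shift p))))
        (subst (suc h ℕ.≤_) (sym (ℕP.+-suc h' (len p))) (ℕP.m≤n⇒m≤1+n (ℕP.≤-trans (ℕP.n≤1+n _) bound)))
        (step plus w e up P , cong (w ℚ.+_) wP)

  liftTo : ∀ {a b h h'} (p : Path M a b) → len p ℕ.< h → + h' ≡ + h ℤ.+ shift p →
           PathNOf a h b h' (weight p)
  liftTo p lt eq = cast-end (ℤP.+-injective (trans end-shift (sym eq))) path
    where open Lifting (lift p lt)

  ascend : ∀ {a d w t} → (∀ h → t ℕ.< h → PathNOf a h a (d ℕ.+ h) w) →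
           ∀ k h → t ℕ.< h → PathNOf a h a (k ℕ.* d ℕ.+ h) (k · w)
  ascend loop zero    h _   = [] , refl
  ascend {d = d} loop (suc k) h t<h =
    cast-end level
      (loop h t<h ++ᴺ ascend loop k (d ℕ.+ h) (ℕP.<-≤-trans t<h (ℕP.m≤n+m h d)))
    where
    level : k ℕ.* d ℕ.+ (d ℕ.+ h) ≡ (d ℕ.+ k ℕ.* d) ℕ.+ h
    level = trans (sym (ℕP.+-assoc (k ℕ.* d) d h)) (cong (ℕ._+ h) (ℕP.+-comm (k ℕ.* d) d))

  descend : ∀ {a d w t} → (∀ h → t ℕ.< h → PathNOf a (d ℕ.+ h) a h w) →
            ∀ k h → t ℕ.< h → PathNOf a (k ℕ.* d ℕ.+ h) a h (k · w)
  descend loop zero    h _   = [] , refl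
  descend {d = d} loop (suc k) h t<h =
    cast-start (sym (ℕP.+-assoc d (k ℕ.* d) h))
      (loop (k ℕ.* d ℕ.+ h) (ℕP.<-≤-trans t<h (ℕP.m≤n+m h _)) ++ᴺ descend loop k h t<h)

  increasing⇒HasInfWeightPath : ∀ {i k j l} (W : ℕ → ℚ) → 1 ℕ.≤ k → 1 ℕ.≤ l →
    (∀ m → PathNOf i k j l (W m)) → (∀ m → W m ℚ.< W (suc m)) → HasInfWeightPath M
  increasing⇒HasInfWeightPath {i} {k} {j} {l} W 1≤k 1≤l P W-inc =
    i , k , j , l , 1≤k , 1≤l , (λ m → proj₁ (P m)) ,
    λ m → subst₂ ℚ._<_ (sym (proj₂ (P m))) (sym (proj₂ (P (suc m)))) (W-inc m)

0<z⇒z≡+s : ∀ {z} → + 0 ℤ.< z → Σ ℕ λ s → z ≡ + s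
0<z⇒z≡+s {+ s} _ = s , refl
0<z⇒z≡+s { -[1+ _ ]} ()

z<0⇒z≡-+s : ∀ {z} → z ℤ.< + 0 → Σ ℕ λ s → z ≡ ℤ.- + s
z<0⇒z≡-+s { -[1+ s ]} _ = suc s , refl
z<0⇒z≡-+s {+ _} (ℤ.+<+ ())

p<q+p : ∀ x {c} → 0ℚ ℚ.< c → x ℚ.< c ℚ.+ x
p<q+p x {c} 0<c = subst (ℚ._< c ℚ.+ x) (ℚP.+-identityˡ x) (ℚP.+-monoˡ-< x 0<c)

module _ {n : ℕ} {M : Mats n} where

  CondI⇒HasInfWeightPath : CondI M → HasInfWeightPath M
  CondI⇒HasInfWeightPath (a , c , len≤n , 0<weight , shift≡0) =
    increasing⇒HasInfWeightPath (_· weight c) (s≤s z≤n) (s≤s z≤n) repeated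
      (λ m → p<q+p (m · weight c) 0<weight)
    where
    loop : ∀ h → n ℕ.< h → PathNOf a h a (0 ℕ.+ h) (weight c)
    loop h n<h = liftTo c (ℕP.≤-<-trans len≤n n<h)
      (sym (trans (cong (λ s → + h ℤ.+ s) shift≡0) (ℤP.+-identityʳ (+ h))))
    repeated : ∀ m → PathNOf a (suc n) a (suc n) (m · weight c)
    repeated m = cast-end (cong (ℕ._+ suc n) (ℕP.*-zeroʳ m))
      (ascend loop m (suc n) (ℕP.n<1+n n))

  module Pumping {a b} (q₁ : Path M a a) (p' : Path M a b) (q₂ : Path M b b)
    (len-p' : len p' ℕ.< n) (len-q₁ : len q₁ ℕ.≤ n) (len-q₂ : len q₂ ℕ.≤ n)
    (s₁ s₂ : ℕ) (shift-q₁ : shift q₁ ≡ + s₁) (shift-q₂ : shift q₂ ≡ ℤ.- + s₂)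
    (gain : 0ℚ ℚ.< s₂ · weight q₁ ℚ.+ s₁ · weight q₂) where

    rise : ∀ h → n ℕ.< h → PathNOf a h a (s₁ ℕ.+ h) (weight q₁)
    rise h n<h = liftTo q₁ (ℕP.≤-<-trans len-q₁ n<h) (begin
      + (s₁ ℕ.+ h)        ≡⟨ ℤP.pos-+ s₁ h ⟩
      + s₁ ℤ.+ + h        ≡⟨ ℤP.+-comm (+ s₁) (+ h) ⟩
      + h ℤ.+ + s₁        ≡⟨ cong (λ s → + h ℤ.+ s) (sym shift-q₁) ⟩
      + h ℤ.+ shift q₁    ∎)
      where open ≡-Reasoning

    fall : ∀ h → n ℕ.< h → PathNOf b (s₂ ℕ.+ h) b h (weight q₂)
    fall h n<h = liftTo q₂ (ℕP.≤-<-trans len-q₂ (ℕP.<-≤-trans n<h (ℕP.m≤n+m h s₂))) (begin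
      + h                            ≡⟨ solve 2 (λ s h → h := (s :+ h) :+ (:- s)) refl (+ s₂) (+ h) ⟩
      (+ s₂ ℤ.+ + h) ℤ.+ ℤ.- + s₂    ≡⟨ cong₂ ℤ._+_ (sym (ℤP.pos-+ s₂ h)) (sym shift-q₂) ⟩
      + (s₂ ℕ.+ h) ℤ.+ shift q₂      ∎)
      where open ≡-Reasoning
            open ℤSolver.+-*-Solver

    H : ℕ
    H = suc (n ℕ.+ n)

    n<H : n ℕ.< H
    n<H = s≤s (ℕP.m≤m+n n n)

    open Lifting (lift p' (ℕP.<-trans len-p' n<H)) renaming (end to E; end-shift to E-shift; end-bound to E-bound)

    n<E : n ℕ.< E
    n<E = ℕP.+-cancelʳ-< (len p') n E (ℕP.<-≤-trans (ℕP.+-monoʳ-< n len-p') (ℕP.≤-trans (ℕP.n≤1+n _) E-bound))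

    cross : ∀ K → PathNOf a (K ℕ.+ H) b (K ℕ.+ E) (weight p')
    cross K = liftTo p' (ℕP.<-≤-trans (ℕP.<-trans len-p' n<H) (ℕP.m≤n+m H K)) (begin
      + (K ℕ.+ E)                    ≡⟨ ℤP.pos-+ K E ⟩
      + K ℤ.+ + E                    ≡⟨ cong (λ e → + K ℤ.+ e) E-shift ⟩
      + K ℤ.+ (+ H ℤ.+ shift p')     ≡⟨ sym (ℤP.+-assoc (+ K) (+ H) (shift p')) ⟩
      (+ K ℤ.+ + H) ℤ.+ shift p'     ≡⟨ cong (ℤ._+ shift p') (sym (ℤP.pos-+ K H)) ⟩
      + (K ℕ.+ H) ℤ.+ shift p'       ∎)
      where open ≡-Reasoning

    W : ℕ → ℚ
    W m = (m ℕ.* s₂) · weight q₁ ℚ.+ (weight p' ℚ.+ (m ℕ.* s₁) · weight q₂)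

    round : ∀ m → PathNOf a H b E (W m)
    round m = ascend rise (m ℕ.* s₂) H n<H ++ᴺ
      (cast-end (cong (ℕ._+ E) turn) (cross (m ℕ.* s₂ ℕ.* s₁)) ++ᴺ
       descend fall (m ℕ.* s₁) E n<E)
      where
      turn : m ℕ.* s₂ ℕ.* s₁ ≡ m ℕ.* s₁ ℕ.* s₂
      turn = trans (ℕP.*-assoc m s₂ s₁) (trans (cong (m ℕ.*_) (ℕP.*-comm s₂ s₁)) (sym (ℕP.*-assoc m s₁ s₂)))

    W-increasing : ∀ m → W m ℚ.< W (suc m)
    W-increasing m = subst (W m ℚ.<_) (sym W-suc) (p<q+p (W m) gain)
      where
      open ℚSolver.+-*-Solver
      W-suc : W (suc m) ≡ (s₂ · weight q₁ ℚ.+ s₁ · weight q₂) ℚ.+ W m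
      W-suc = trans
        (cong₂ (λ x y → x ℚ.+ (weight p' ℚ.+ y))
               (×-homo-+ (weight q₁) s₂ (m ℕ.* s₂)) (×-homo-+ (weight q₂) s₁ (m ℕ.* s₁)))
        (solve 5 (λ c₁ c₂ u w v → (c₁ :+ u) :+ (w :+ (c₂ :+ v)) := (c₁ :+ c₂) :+ (u :+ (w :+ v)))
          refl (s₂ · weight q₁) (s₁ · weight q₂) ((m ℕ.* s₂) · weight q₁) (weight p') ((m ℕ.* s₁) · weight q₂))

    pumped : HasInfWeightPath M
    pumped = increasing⇒HasInfWeightPath W (s≤s z≤n) (ℕP.≤-trans (s≤s z≤n) n<E) round W-increasing

  CondII⇒HasInfWeightPath : CondII M → HasInfWeightPath M
  CondII⇒HasInfWeightPath (a , b , q₁ , p' , q₂ , _ , _ , len-p' , len-q₁ , len-q₂ , 0<s₁ , s₂<0 , 0<gain)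
    with 0<z⇒z≡+s 0<s₁ | z<0⇒z≡-+s s₂<0
  ... | s₁ , shift-q₁ | s₂ , shift-q₂ =
    Pumping.pumped q₁ p' q₂ len-p' len-q₁ len-q₂ s₁ s₂ shift-q₁ shift-q₂ (subst (0ℚ ℚ.<_) gain≡ 0<gain)
    where
    gain≡ : ℚ.- ℤ→ℚ (shift q₂) ℚ.* weight q₁ ℚ.+ ℤ→ℚ (shift q₁) ℚ.* weight q₂
          ≡ s₂ · weight q₁ ℚ.+ s₁ · weight q₂
    gain≡ rewrite shift-q₁ | shift-q₂ | sym (ℤ→ℚ-homo‿- (ℤ.- + s₂)) | ℤP.neg-involutive (+ s₂) =
      sym (cong₂ ℚ._+_ (·≡ℤ→ℚ-* s₂ (weight q₁)) (·≡ℤ→ℚ-* s₁ (weight q₂)))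

-- Enumerating short paths

∈-concatMap⁺′ : ∀ {A B : Set} {f : A → List B} {x xs y} → x ∈ xs → y ∈ f x → y ∈ concatMap f xs
∈-concatMap⁺′ {f = f} x∈xs y∈fx = ∈P.∈-concatMap⁺ f (Any.map (λ { refl → y∈fx }) x∈xs)

shifts : List Shift
shifts = minus ∷ zero ∷ plus ∷ []

∈-shifts : ∀ s → s ∈ shifts
∈-shifts minus = Any.here refl
∈-shifts zero  = Any.there (Any.here refl)
∈-shifts plus  = Any.there (Any.there (Any.here refl))

module _ {n : ℕ} (M : Mats n) where

  PathFrom : Fin n → Set
  PathFrom i = Σ (Fin n) (Path M i)

  prepend : ∀ s j i (m : ℚ∞) → M s j i ≡ m → List (PathFrom j) → List (PathFrom i)
  prepend s j i (just w) e ps = map (λ (k , p) → k , step s w e p) ps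
  prepend s j i nothing  e ps = []

  pathsUpTo  : ℕ → (i : Fin n) → List (PathFrom i)
  extensions : ℕ → (i : Fin n) → Shift → Fin n → List (PathFrom i)
  pathsUpTo zero    i = (i , []) ∷ []
  pathsUpTo (suc L) i = (i , []) ∷ concatMap (λ s → concatMap (extensions L i s) (allFin n)) shifts
  extensions L i s j = prepend s j i (M s j i) refl (pathsUpTo L j)

  -- prepend builds arcs from the proof refl, so membership needs uniqueness
  -- of proofs of M s j i ≡ just w.
  ∈-prepend : ∀ {s j i k w} (m : ℚ∞) (e : M s j i ≡ m) (e' : M s j i ≡ just w) {ps} {p : Path M j k} →
              (k , p) ∈ ps → (k , step s w e' p) ∈ prepend s j i m e ps
  ∈-prepend nothing  e e' _ with () ← trans (sym e') e
  ∈-prepend (just _) e e' p∈ps with refl ← trans (sym e') e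
    with refl ← Decidable⇒UIP.≡-irrelevant (MaybeP.≡-dec ℚP._≟_) e e' =
    ∈P.∈-map⁺ (λ (k , p) → k , step _ _ e p) p∈ps

  ∈-pathsUpTo : ∀ {i j} (p : Path M i j) L → len p ℕ.≤ L → (j , p) ∈ pathsUpTo L i
  ∈-pathsUpTo []             zero    _ = Any.here refl
  ∈-pathsUpTo []             (suc L) _ = Any.here refl
  ∈-pathsUpTo {i} (step {j = j} s w e p) (suc L) (s≤s len≤L) =
    Any.there (∈-concatMap⁺′ {f = λ s → concatMap (extensions L i s) (allFin n)} (∈-shifts s)
      (∈-concatMap⁺′ {f = extensions L i s} (∈P.∈-allFin j)
      (∈-prepend _ refl e (∈-pathsUpTo p L len≤L))))

  IsCondICircuit : (a : Fin n) → PathFrom a → Set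
  IsCondICircuit a (j , c) = (j ≡ a) × (len c ℕ.≤ n) × (0ℚ ℚ.< weight c) × (shift c ≡ + 0)

  condI? : Dec (CondI M)
  condI? = Dec.map′ sound complete
    (FinP.any? λ a → Any.any? (λ (j , c) → (j FinP.≟ a) ×-dec (len c ℕ.≤? n) ×-dec
                                            (0ℚ ℚP.<? weight c) ×-dec (shift c ℤP.≟ + 0))
                              (pathsUpTo n a))
    where
    sound : ∃ (λ a → Any.Any (IsCondICircuit a) (pathsUpTo n a)) → CondI M
    sound (a , found) with (_ , c) , refl , conditions ← Any.satisfied found = a , c , conditions
    complete : CondI M → ∃ (λ a → Any.Any (IsCondICircuit a) (pathsUpTo n a))
    complete (a , c , conditions@(len≤n , _)) = a , lose (∈-pathsUpTo c n len≤n) (refl , conditions)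

  IsCondIITriple : (a b : Fin n) → PathFrom a → PathFrom a → PathFrom b → Set
  IsCondIITriple a b (j₁ , q₁) (j₂ , p') (j₃ , q₂) =
    (j₁ ≡ a) × (j₂ ≡ b) × (j₃ ≡ b) ×
    (len p' ℕ.< n) × (len q₁ ℕ.≤ n) × (len q₂ ℕ.≤ n) ×
    (+ 0 ℤ.< shift q₁) × (shift q₂ ℤ.< + 0) ×
    (0ℚ ℚ.< ℚ.- ℤ→ℚ (shift q₂) ℚ.* weight q₁ ℚ.+ ℤ→ℚ (shift q₁) ℚ.* weight q₂)

  isCondIITriple? : ∀ a b x₁ x₂ x₃ → Dec (IsCondIITriple a b x₁ x₂ x₃)
  isCondIITriple? a b (j₁ , q₁) (j₂ , p') (j₃ , q₂) =
    (j₁ FinP.≟ a) ×-dec (j₂ FinP.≟ b) ×-dec (j₃ FinP.≟ b) ×-dec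
    (len p' ℕ.<? n) ×-dec (len q₁ ℕ.≤? n) ×-dec (len q₂ ℕ.≤? n) ×-dec
    (+ 0 ℤP.<? shift q₁) ×-dec (shift q₂ ℤP.<? + 0) ×-dec (0ℚ ℚP.<? _)

  CondIITriples : Set
  CondIITriples = ∃ λ a → ∃ λ b →
    Any.Any (λ x₁ → Any.Any (λ x₂ → Any.Any (IsCondIITriple a b x₁ x₂) (pathsUpTo n b))
                            (pathsUpTo (ℕ.pred n) a))
            (pathsUpTo n a)

  condII? : Dec (CondII M)
  condII? = Dec.map′ sound complete
    (FinP.any? λ a → FinP.any? λ b →
      Any.any? (λ x₁ → Any.any? (λ x₂ → Any.any? (isCondIITriple? a b x₁ x₂)
        (pathsUpTo n b)) (pathsUpTo (ℕ.pred n) a)) (pathsUpTo n a))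
    where
    sound : CondIITriples → CondII M
    sound (a , b , found₁)
      with (_ , q₁) , found₂ ← Any.satisfied found₁
      with (_ , p') , found₃ ← Any.satisfied found₂
      with (_ , q₂) , refl , refl , refl , conditions ← Any.satisfied found₃ =
      a , b , q₁ , p' , q₂ , q₁ ++ (p' ++ q₂) , refl , conditions
    complete : CondII M → CondIITriples
    complete (a , b , q₁ , p' , q₂ , _ , _ , conditions@(len-p' , len-q₁ , len-q₂ , _)) =
      a , b , lose (∈-pathsUpTo q₁ n len-q₁) (lose (∈-pathsUpTo p' (ℕ.pred n) (ℕP.<⇒≤pred len-p'))
                (lose (∈-pathsUpTo q₂ n len-q₂) (refl , refl , refl , conditions)))

-- Removing circuits

module _ {n : ℕ} {M : Mats n} where

  node : ∀ {x y} (p : Path M x y) → Fin (suc (len p)) → Fin n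
  node {x} p              Fin.zero    = x
  node     (step s w e p) (Fin.suc i) = node p i

  prefix : ∀ {x y} (p : Path M x y) (i : Fin (suc (len p))) → Path M x (node p i)
  prefix p              Fin.zero    = []
  prefix (step s w e p) (Fin.suc i) = step s w e (prefix p i)

  suffix : ∀ {x y} (p : Path M x y) (i : Fin (suc (len p))) → Path M (node p i) y
  suffix p              Fin.zero    = p
  suffix (step s w e p) (Fin.suc i) = suffix p i

  prefix++suffix : ∀ {x y} (p : Path M x y) i → prefix p i ++ suffix p i ≡ p
  prefix++suffix p              Fin.zero    = refl
  prefix++suffix (step s w e p) (Fin.suc i) = cong (step s w e) (prefix++suffix p i)

  len-prefix : ∀ {x y} (p : Path M x y) i → len (prefix p i) ≡ toℕ i
  len-prefix p              Fin.zero    = refl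
  len-prefix (step s w e p) (Fin.suc i) = cong suc (len-prefix p i)

  Segment : ∀ {x y} (p : Path M x y) (a b : Fin n) (L : ℕ) → Set
  Segment {x} {y} p a b L = Σ (Path M x a) λ A → Σ (Path M a b) λ C → Σ (Path M b y) λ B →
    (p ≡ A ++ (C ++ B)) × (1 ℕ.≤ len C) × (len C ℕ.≤ L)

  segment : ∀ {x y} (p : Path M x y) (i j : Fin (suc (len p))) → toℕ i ℕ.< toℕ j →
            Segment p (node p i) (node p j) (toℕ j)
  segment (step s w e p) Fin.zero (Fin.suc j) _ =
    [] , step s w e (prefix p j) , suffix p j , cong (step s w e) (sym (prefix++suffix p j)) ,
    s≤s z≤n , ℕP.≤-reflexive (cong suc (len-prefix p j))
  segment (step s w e p) (Fin.suc i) (Fin.suc j) (s≤s i<j) with segment p i j i<j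
  ... | A , C , B , p≡ , 1≤len , len≤ = step s w e A , C , B , cong (step s w e) p≡ , 1≤len , ℕP.m≤n⇒m≤1+n len≤

  record CircuitSplit {x y} (p : Path M x y) : Set where
    constructor circuitSplit
    field
      {z}              : Fin n
      before           : Path M x z
      circuit          : Path M z z
      after            : Path M z y
      decomposition    : p ≡ before ++ (circuit ++ after)
      circuit-nonempty : 1 ℕ.≤ len circuit
      circuit-short    : len circuit ℕ.≤ n

    withoutCircuit : Path M x y
    withoutCircuit = before ++ after

  -- Among the first n+1 nodes of p two coincide (pigeonhole).
  findCircuit : ∀ {x y} (p : Path M x y) → n ℕ.≤ len p → CircuitSplit p
  findCircuit p n≤len with i , j , i<j , same ← FinP.pigeonhole (ℕP.n<1+n n) (λ k → node p (inject≤ k (s≤s n≤len)))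
    = toSplit same (segment p (inj i) (inj j) (subst₂ ℕ._<_ (sym (toℕ-inj i)) (sym (toℕ-inj j)) i<j))
    where
    inj : Fin (suc n) → Fin (suc (len p))
    inj k = inject≤ k (s≤s n≤len)
    toℕ-inj : ∀ k → toℕ (inj k) ≡ toℕ k
    toℕ-inj k = FinP.toℕ-inject≤ k (s≤s n≤len)
    toSplit : ∀ {a b} → a ≡ b → Segment p a b (toℕ (inj j)) → CircuitSplit p
    toSplit refl (A , C , B , p≡ , 1≤len , len≤) =
      circuitSplit A C B p≡ 1≤len (ℕP.≤-trans len≤ (ℕP.≤-trans (ℕP.≤-reflexive (toℕ-inj j)) (FinP.toℕ≤pred[n] j)))

  len-withoutCircuit : ∀ {x y} {p : Path M x y} (cs : CircuitSplit p) →
                       len (CircuitSplit.withoutCircuit cs) ℕ.< len p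
  len-withoutCircuit {p = p} (circuitSplit A C B refl 1≤len _) = begin-strict
    len (A ++ B)              ≡⟨ len-++ A B ⟩
    len A ℕ.+ len B           <⟨ ℕP.+-monoʳ-< (len A) (ℕP.+-monoˡ-< (len B) 1≤len) ⟩
    len A ℕ.+ (len C ℕ.+ len B) ≡⟨ cong (len A ℕ.+_) (len-++ C B) ⟨
    len A ℕ.+ len (C ++ B)    ≡⟨ len-++ A (C ++ B) ⟨
    len (A ++ (C ++ B))       ∎
    where open ℕP.≤-Reasoning

  circuitRemoval-ind : (P : ∀ {x y} → Path M x y → Set) →
    (∀ {x y} (p : Path M x y) → len p ℕ.< n → P p) →
    (∀ {x y} {p : Path M x y} (cs : CircuitSplit p) → P (CircuitSplit.withoutCircuit cs) → P p) →
    ∀ {x y} (p : Path M x y) → P p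
  circuitRemoval-ind P short removal p = go (suc (len p)) p (ℕP.n<1+n _)
    where
    go : ∀ N {x y} (p : Path M x y) → len p ℕ.< N → P p
    go (suc N) p len<N with len p ℕ.<? n
    ... | yes len<n = short p len<n
    ... | no  len≮n = removal cs (go N _ (ℕP.<-≤-trans (len-withoutCircuit cs) (ℕP.≤-pred len<N)))
      where cs = findCircuit p (ℕP.≮⇒≥ len≮n)

  shortcut : ∀ {x y} → Path M x y → Σ (Path M x y) λ q → len q ℕ.< n
  shortcut = circuitRemoval-ind (λ {x} {y} _ → Σ (Path M x y) λ q → len q ℕ.< n) (_,_) (λ _ q → q)

-- The potential

sucℚ : ℕ → ℚ
sucℚ σ = ℤ→ℚ (+ suc σ)

0<sucℚ : ∀ σ → 0ℚ ℚ.< sucℚ σ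
0<sucℚ σ = ℤ→ℚ-mono-< {+ 0} {+ suc σ} (ℤ.+<+ (s≤s z≤n))

1≤sucℚ : ∀ σ → 1ℚ ℚ.≤ sucℚ σ
1≤sucℚ σ = ℤ→ℚ-mono-≤ {+ 1} {+ suc σ} (ℤ.+≤+ (s≤s z≤n))

sucℚ-nonZero : ∀ σ → ℚ.NonZero (sucℚ σ)
sucℚ-nonZero σ = ℚP.pos⇒nonZero (sucℚ σ) {{ℚ.positive (0<sucℚ σ)}}

_÷suc_ : ℚ → ℕ → ℚ
w ÷suc σ = (w ℚ.÷ sucℚ σ) {{sucℚ-nonZero σ}}

÷suc-* : ∀ w σ → (w ÷suc σ) ℚ.* sucℚ σ ≡ w
÷suc-* w σ = trans (ℚP.*-assoc w _ (sucℚ σ))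
  (trans (cong (w ℚ.*_) (ℚP.*-inverseˡ (sucℚ σ) {{sucℚ-nonZero σ}}))
         (ℚP.*-identityʳ w))

÷suc-bound : ∀ w₁ w₂ σ₁ σ → sucℚ σ ℚ.* w₁ ℚ.+ sucℚ σ₁ ℚ.* w₂ ℚ.≤ 0ℚ →
             w₂ ℚ.≤ (w₁ ÷suc σ₁) ℚ.* ℚ.- sucℚ σ
÷suc-bound w₁ w₂ σ₁ σ sum≤0 =
  ℚP.*-cancelˡ-≤-pos S₁ {{ℚ.positive (0<sucℚ σ₁)}} (begin
    S₁ ℚ.* w₂                             ≡⟨ solve 3 (λ a b c → c := (a :* b :+ c) :- a :* b) refl S w₁ (S₁ ℚ.* w₂) ⟩
    (S ℚ.* w₁ ℚ.+ S₁ ℚ.* w₂) ℚ.- S ℚ.* w₁ ≤⟨ ℚP.+-monoˡ-≤ (ℚ.- (S ℚ.* w₁)) sum≤0 ⟩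
    0ℚ ℚ.- S ℚ.* w₁                       ≡⟨ ℚP.+-identityˡ _ ⟩
    ℚ.- (S ℚ.* w₁)                         ≡⟨ cong (λ x → ℚ.- (S ℚ.* x)) (÷suc-* w₁ σ₁) ⟨
    ℚ.- (S ℚ.* (w₁ ÷suc σ₁ ℚ.* S₁))        ≡⟨ solve 3 (λ s s₁ x → :- (s :* (x :* s₁)) := s₁ :* (x :* (:- s))) refl S S₁ (w₁ ÷suc σ₁) ⟩
    S₁ ℚ.* ((w₁ ÷suc σ₁) ℚ.* ℚ.- S)       ∎)
  where
  S S₁ : ℚ
  S = sucℚ σ
  S₁ = sucℚ σ₁
  open ℚP.≤-Reasoning
  open ℚSolver.+-*-Solver

module Potential {n : ℕ} (M : Mats n) (¬I : ¬ CondI M) (¬II : ¬ CondII M) where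

  record Candidate (y : Fin n) : Set where
    constructor candidate
    field
      {root}        : Fin n
      circuit       : Path M root root
      route         : Path M root y
      circuit-short : len circuit ℕ.≤ n
      route-short   : len route ℕ.< n
      σ             : ℕ
      circuit-shift : shift circuit ≡ + suc σ

  slope : ∀ {y} → Candidate y → ℚ
  slope c = weight circuit ÷suc σ
    where open Candidate c

  candidateFrom : ∀ {a y j₁ j₂} (C : Path M a j₁) (p : Path M a j₂) → Dec (j₁ ≡ a) → Dec (j₂ ≡ y) →
                  Dec (len C ℕ.≤ n) → Dec (len p ℕ.< n) → (z : ℤ) → shift C ≡ z → Maybe (Candidate y)
  candidateFrom C p (yes refl) (yes refl) (yes C-short) (yes p-short) (+ suc σ) C-shift =
    just (candidate C p C-short p-short σ C-shift)
  candidateFrom _ _ _ _ _ _ _ _ = nothing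

  toCandidate : ∀ y a → PathFrom M a → PathFrom M a → Maybe (Candidate y)
  toCandidate y a (j₁ , C) (j₂ , p) =
    candidateFrom C p (j₁ FinP.≟ a) (j₂ FinP.≟ y) (len C ℕ.≤? n) (len p ℕ.<? n) (shift C) refl

  candidatesThrough : ∀ y a → PathFrom M a → List (Candidate y)
  candidatesThrough y a x₁ = concatMap (λ x₂ → fromMaybe (toCandidate y a x₁ x₂)) (pathsUpTo M (ℕ.pred n) a)

  candidatesAt : ∀ y a → List (Candidate y)
  candidatesAt y a = concatMap (candidatesThrough y a) (pathsUpTo M n a)

  candidates : ∀ y → List (Candidate y)
  candidates y = concatMap (candidatesAt y) (allFin n)

  candidateFrom-complete : ∀ {a y} (C : Path M a a) (p : Path M a y) → len C ℕ.≤ n → len p ℕ.< n →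
    ∀ σ → shift C ≡ + suc σ → ∀ d₁ d₂ d₃ d₄ z (e : shift C ≡ z) →
    Σ (Candidate y) λ c → c ∈ fromMaybe (candidateFrom C p d₁ d₂ d₃ d₄ z e) × slope c ≡ weight C ÷suc σ
  candidateFrom-complete C p _ _ _ _ (no a≢a) _ _ _ _ _ = ⊥-elim (a≢a refl)
  candidateFrom-complete C p _ _ _ _ (yes refl) (no y≢y) _ _ _ _ = ⊥-elim (y≢y refl)
  candidateFrom-complete C p C-short _ _ _ (yes refl) (yes refl) (no long) _ _ _ = ⊥-elim (long C-short)
  candidateFrom-complete C p _ p-short _ _ (yes refl) (yes refl) (yes _) (no long) _ _ = ⊥-elim (long p-short)
  candidateFrom-complete C p _ _ σ C-shift (yes refl) (yes refl) (yes C-short) (yes p-short) z e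
    with refl ← trans (sym C-shift) e = candidate C p C-short p-short σ e , Any.here refl , refl

  ∈-candidates : ∀ {a y} (C : Path M a a) (p : Path M a y) → len C ℕ.≤ n → len p ℕ.< n →
    ∀ σ → shift C ≡ + suc σ → Σ (Candidate y) λ c → c ∈ candidates y × slope c ≡ weight C ÷suc σ
  ∈-candidates {a} {y} C p C-short p-short σ C-shift
    with c , c∈ , slope-c ← candidateFrom-complete C p C-short p-short σ C-shift
           (a FinP.≟ a) (y FinP.≟ y) (len C ℕ.≤? n) (len p ℕ.<? n) (shift C) refl =
    c , ∈-concatMap⁺′ {f = candidatesAt y} (∈P.∈-allFin a)
          (∈-concatMap⁺′ {f = candidatesThrough y a} (∈-pathsUpTo M C n C-short)
            (∈-concatMap⁺′ {f = λ x₂ → fromMaybe (toCandidate y a (a , C) x₂)}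
              (∈-pathsUpTo M p (ℕ.pred n) (ℕP.<⇒≤pred p-short)) c∈)) ,
    slope-c

  opaque
    shortWeights : List ℚ
    shortWeights = concatMap (λ b → map (λ (_ , q) → weight q) (pathsUpTo M n b)) (allFin n)

    T : ℚ
    T = max 0ℚ shortWeights

    0≤T : 0ℚ ℚ.≤ T
    0≤T = v≤max⁺ 0ℚ shortWeights (inj₁ ℚP.≤-refl)

    weight≤T : ∀ {b c} (q : Path M b c) → len q ℕ.≤ n → weight q ℚ.≤ T
    weight≤T {b} q q-short = All.lookup (xs≤max 0ℚ shortWeights)
      (∈-concatMap⁺′ {f = λ b → map (λ (_ , q) → weight q) (pathsUpTo M n b)} (∈P.∈-allFin b)
        (∈P.∈-map⁺ (λ (_ , q) → weight q) (∈-pathsUpTo M q n q-short)))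

    -- The default -T only has to give w(C) ≤ -T · s(C) for short circuits C with s(C) < 0.
    r : Fin n → ℚ
    r y = max (ℚ.- T) (map slope (candidates y))

    r-induction : ∀ y (P : ℚ → Set) → P (ℚ.- T) → (∀ (c : Candidate y) → P (slope c)) → P (r y)
    r-induction y P P-T P-slope =
      argmax-all (λ x → x) {P = P} P-T (All.map⁺ {f = slope {y}} (All.universal P-slope (candidates y)))

    -T≤r : ∀ y → ℚ.- T ℚ.≤ r y
    -T≤r y = v≤max⁺ (ℚ.- T) (map slope (candidates y)) (inj₁ ℚP.≤-refl)

    slope≤r : ∀ {y} (c : Candidate y) → slope c ℚ.≤ r y
    slope≤r {y} (candidate C p C-short p-short σ C-shift)
      with c , c∈ , slope-c ← ∈-candidates C p C-short p-short σ C-shift =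
      subst (ℚ._≤ r y) slope-c (All.lookup (xs≤max (ℚ.- T) (map slope (candidates y))) (∈P.∈-map⁺ slope c∈))

  extend : ∀ {u v} → Candidate u → Path M u v → Candidate v
  extend (candidate C p C-short _ σ C-shift) Q =
    candidate C (proj₁ (shortcut (p ++ Q))) C-short (proj₂ (shortcut (p ++ Q))) σ C-shift

  r-mono : ∀ {u v} → Path M u v → r u ℚ.≤ r v
  r-mono {u} {v} Q = r-induction u (ℚ._≤ r v) (-T≤r v) (λ c → slope≤r (extend c Q))

  circuit-weight≤ : ∀ {b} (C : Path M b b) → len C ℕ.≤ n → weight C ℚ.≤ r b ℚ.* ℤ→ℚ (shift C)
  circuit-weight≤ {b} C C-short = bySign (shift C) refl
    where
    bySign : ∀ z → shift C ≡ z → weight C ℚ.≤ r b ℚ.* ℤ→ℚ z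
    bySign (+ zero) C-shift =
      subst (weight C ℚ.≤_) (sym (ℚP.*-zeroʳ (r b))) (ℚP.≮⇒≥ λ 0<w → ¬I (b , C , C-short , 0<w , C-shift))
    bySign (+ suc σ) C-shift = begin
      weight C                ≡⟨ ÷suc-* (weight C) σ ⟨
      (weight C ÷suc σ) ℚ.* S ≤⟨ ℚP.*-monoʳ-≤-nonNeg S {{ℚ.nonNegative (ℚP.<⇒≤ (0<sucℚ σ))}} (slope≤r c) ⟩
      r b ℚ.* S               ∎
      where
      S = sucℚ σ
      c = candidate C [] C-short (ℕP.≤-<-trans z≤n (FinP.toℕ<n b)) σ C-shift
      open ℚP.≤-Reasoning
    bySign -[1+ σ ] C-shift = subst (λ x → weight C ℚ.≤ r b ℚ.* x) (sym (ℤ→ℚ-homo‿- (+ suc σ)))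
      (r-induction b (λ x → weight C ℚ.≤ x ℚ.* ℚ.- S) default fromCandidate)
      where
      S = sucℚ σ
      open ℚSolver.+-*-Solver
      default : weight C ℚ.≤ ℚ.- T ℚ.* ℚ.- S
      default = begin
        weight C        ≤⟨ weight≤T C C-short ⟩
        T               ≡⟨ ℚP.*-identityʳ T ⟨
        T ℚ.* 1ℚ        ≤⟨ ℚP.*-monoˡ-≤-nonNeg T {{ℚ.nonNegative 0≤T}} (1≤sucℚ σ) ⟩
        T ℚ.* S         ≡⟨ solve 2 (λ t s → t :* s := (:- t) :* (:- s)) refl T S ⟩
        ℚ.- T ℚ.* ℚ.- S ∎
        where open ℚP.≤-Reasoning
      fromCandidate : ∀ c → weight C ℚ.≤ slope c ℚ.* ℚ.- S
      fromCandidate (candidate {a} C₁ p C₁-short p-short σ₁ C₁-shift) =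
        ÷suc-bound (weight C₁) (weight C) σ₁ σ (subst (ℚ._≤ 0ℚ) gain≡ (ℚP.≮⇒≥ λ 0<gain →
          ¬II (a , b , C₁ , p , C , _ , refl , p-short , C₁-short , C-short ,
               subst (+ 0 ℤ.<_) (sym C₁-shift) (ℤ.+<+ (s≤s z≤n)) , subst (ℤ._< + 0) (sym C-shift) ℤ.-<+ ,
               0<gain)))
        where
        gain≡ : ℚ.- ℤ→ℚ (shift C) ℚ.* weight C₁ ℚ.+ ℤ→ℚ (shift C₁) ℚ.* weight C
              ≡ S ℚ.* weight C₁ ℚ.+ sucℚ σ₁ ℚ.* weight C
        gain≡ = trans (cong₂ (λ z z₁ → ℚ.- ℤ→ℚ z ℚ.* weight C₁ ℚ.+ ℤ→ℚ z₁ ℚ.* weight C) C-shift C₁-shift)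
                      (cong (λ x → x ℚ.* weight C₁ ℚ.+ sucℚ σ₁ ℚ.* weight C) (sym (ℤ→ℚ-homo‿- -[1+ σ ])))

  drift : ∀ {x y} → Path M x y → ℚ
  drift []                 = 0ℚ
  drift (step {i} s _ _ p) = r i ℚ.* ℤ→ℚ (shiftℤ s) ℚ.+ drift p

  drift-++ : ∀ {i j k} (p : Path M i j) (q : Path M j k) → drift (p ++ q) ≡ drift p ℚ.+ drift q
  drift-++ []                 q = sym (ℚP.+-identityˡ _)
  drift-++ (step {i} s w e p) q =
    trans (cong (r i ℚ.* ℤ→ℚ (shiftℤ s) ℚ.+_) (drift-++ p q)) (sym (ℚP.+-assoc (r i ℚ.* ℤ→ℚ (shiftℤ s)) (drift p) (drift q)))

  -- Nodes on a common circuit reach each other, so r is constant there.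
  drift-onCircuit : ∀ {x y z} (into : Path M z x) (p : Path M x y) (back : Path M y z) →
                    drift p ≡ r z ℚ.* ℤ→ℚ (shift p)
  drift-onCircuit {z = z} _ [] _ = sym (ℚP.*-zeroʳ (r z))
  drift-onCircuit {x} {z = z} into (step s w e p) back = begin
    r x ℚ.* ℤ→ℚ (shiftℤ s) ℚ.+ drift p                        ≡⟨ cong₂ ℚ._+_ (cong (ℚ._* ℤ→ℚ (shiftℤ s)) r-x≡r-z)
                                                                           (drift-onCircuit (into ++ step s w e []) p back) ⟩
    r z ℚ.* ℤ→ℚ (shiftℤ s) ℚ.+ r z ℚ.* ℤ→ℚ (shift p)          ≡⟨ ℚP.*-distribˡ-+ (r z) _ _ ⟨
    r z ℚ.* (ℤ→ℚ (shiftℤ s) ℚ.+ ℤ→ℚ (shift p))                ≡⟨ cong (r z ℚ.*_) (ℤ→ℚ-homo-+ (shiftℤ s) (shift p)) ⟨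
    r z ℚ.* ℤ→ℚ (shiftℤ s ℤ.+ shift p)                        ∎
    where
    open ≡-Reasoning
    r-x≡r-z : r x ≡ r z
    r-x≡r-z = ℚP.≤-antisym (r-mono (step s w e p ++ back)) (r-mono into)

  circuit-weight≤drift : ∀ {z} (C : Path M z z) → len C ℕ.≤ n → weight C ℚ.≤ drift C
  circuit-weight≤drift C C-short = subst (weight C ℚ.≤_) (sym (drift-onCircuit [] C [])) (circuit-weight≤ C C-short)

  excesses : List ℚ
  excesses = concatMap (λ x → map (λ (_ , q) → weight q ℚ.- drift q) (pathsUpTo M (ℕ.pred n) x)) (allFin n)

  excess : ℚ
  excess = max 0ℚ excesses

  -- Removing a circuit C lowers the weight by w(C) and the drift by at least as much.
  weight≤excess+drift : ∀ {x y} (p : Path M x y) → weight p ℚ.≤ excess ℚ.+ drift p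
  weight≤excess+drift = circuitRemoval-ind (λ p → weight p ℚ.≤ excess ℚ.+ drift p) short removal
    where
    open ℚSolver.+-*-Solver
    short : ∀ {x y} (p : Path M x y) → len p ℕ.< n → weight p ℚ.≤ excess ℚ.+ drift p
    short {x} p p-short =
      subst (ℚ._≤ excess ℚ.+ drift p) (solve 2 (λ w d → (w :- d) :+ d := w) refl (weight p) (drift p))
        (ℚP.+-monoˡ-≤ (drift p) (All.lookup (xs≤max 0ℚ excesses)
          (∈-concatMap⁺′ {f = λ x → map (λ (_ , q) → weight q ℚ.- drift q) (pathsUpTo M (ℕ.pred n) x)}
            (∈P.∈-allFin x)
            (∈P.∈-map⁺ (λ (_ , q) → weight q ℚ.- drift q) (∈-pathsUpTo M p (ℕ.pred n) (ℕP.<⇒≤pred p-short))))))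
    removal : ∀ {x y} {p : Path M x y} (cs : CircuitSplit p) →
              weight (CircuitSplit.withoutCircuit cs) ℚ.≤ excess ℚ.+ drift (CircuitSplit.withoutCircuit cs) →
              weight p ℚ.≤ excess ℚ.+ drift p
    removal (circuitSplit A C B refl _ C-short) ih = begin
      weight (A ++ (C ++ B))                              ≡⟨ trans (weight-++ A (C ++ B)) (cong (weight A ℚ.+_) (weight-++ C B)) ⟩
      weight A ℚ.+ (weight C ℚ.+ weight B)                ≡⟨ solve 3 (λ a c b → a :+ (c :+ b) := (a :+ b) :+ c) refl (weight A) (weight C) (weight B) ⟩
      (weight A ℚ.+ weight B) ℚ.+ weight C                ≡⟨ cong (ℚ._+ weight C) (weight-++ A B) ⟨
      weight (A ++ B) ℚ.+ weight C                        ≤⟨ ℚP.+-mono-≤ ih (circuit-weight≤drift C C-short) ⟩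
      (excess ℚ.+ drift (A ++ B)) ℚ.+ drift C             ≡⟨ cong (λ d → (excess ℚ.+ d) ℚ.+ drift C) (drift-++ A B) ⟩
      (excess ℚ.+ (drift A ℚ.+ drift B)) ℚ.+ drift C      ≡⟨ solve 4 (λ e a b c → (e :+ (a :+ b)) :+ c := e :+ (a :+ (c :+ b))) refl excess (drift A) (drift B) (drift C) ⟩
      excess ℚ.+ (drift A ℚ.+ (drift C ℚ.+ drift B))      ≡⟨ cong (excess ℚ.+_) (trans (drift-++ A (C ++ B)) (cong (drift A ℚ.+_) (drift-++ C B))) ⟨
      excess ℚ.+ drift (A ++ (C ++ B))                    ∎
      where open ℚP.≤-Reasoning

  -- Counted from 0, so that levels are non-negative; this is what lets the
  -- monotonicity of r enter the telescoping below.
  level : ℕ → ℚ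
  level h = ℤ→ℚ (+ ℕ.pred h)

  0≤level : ∀ h → 0ℚ ℚ.≤ level h
  0≤level h = ℤ→ℚ-mono-≤ {+ 0} {+ ℕ.pred h} (ℤ.+≤+ z≤n)

  move-shift : ∀ {s h h'} → Move s h h' → ℤ→ℚ (shiftℤ s) ≡ level h' ℚ.- level h
  move-shift (down {k}) = begin
    ℤ→ℚ -[1+ 0 ]                             ≡⟨ solve 1 (λ x → :- con 1ℚ := x :- (con 1ℚ :+ x)) refl (ℤ→ℚ (+ k)) ⟩
    ℤ→ℚ (+ k) ℚ.- (1ℚ ℚ.+ ℤ→ℚ (+ k))         ≡⟨ cong (λ x → ℤ→ℚ (+ k) ℚ.- x) (ℤ→ℚ-homo-+ (+ 1) (+ k)) ⟨
    ℤ→ℚ (+ k) ℚ.- ℤ→ℚ (+ suc k)              ∎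
    where open ≡-Reasoning
          open ℚSolver.+-*-Solver
  move-shift (stay {k}) = sym (ℚP.+-inverseʳ (ℤ→ℚ (+ k)))
  move-shift (up {k}) = begin
    1ℚ                                       ≡⟨ solve 1 (λ x → con 1ℚ := (con 1ℚ :+ x) :- x) refl (ℤ→ℚ (+ k)) ⟩
    (1ℚ ℚ.+ ℤ→ℚ (+ k)) ℚ.- ℤ→ℚ (+ k)         ≡⟨ cong (ℚ._- ℤ→ℚ (+ k)) (ℤ→ℚ-homo-+ (+ 1) (+ k)) ⟨
    ℤ→ℚ (+ suc k) ℚ.- ℤ→ℚ (+ k)              ∎
    where open ≡-Reasoning
          open ℚSolver.+-*-Solver

  drift∘project≤ : ∀ {x h y l} (P : PathN M x h y l) →
                   drift (project P) ℚ.≤ r y ℚ.* level l ℚ.- r x ℚ.* level h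
  drift∘project≤ {x} {h} [] = ℚP.≤-reflexive (sym (ℚP.+-inverseʳ (r x ℚ.* level h)))
  drift∘project≤ {x} {h} {y} {l} (step {j = x'} {k' = h'} s w e move P) = begin
    r x ℚ.* σ ℚ.+ drift (project P)                        ≤⟨ ℚP.+-monoʳ-≤ (r x ℚ.* σ) (drift∘project≤ P) ⟩
    r x ℚ.* σ ℚ.+ (r y ℚ.* level l ℚ.- r x' ℚ.* level h')  ≤⟨ ℚP.+-monoʳ-≤ (r x ℚ.* σ) (ℚP.+-monoʳ-≤ (r y ℚ.* level l)
                                                                (ℚP.neg-antimono-≤ r-x≤r-x')) ⟩
    r x ℚ.* σ ℚ.+ (r y ℚ.* level l ℚ.- r x ℚ.* level h')   ≡⟨ cong (λ t → r x ℚ.* t ℚ.+ (r y ℚ.* level l ℚ.- r x ℚ.* level h'))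
                                                                (move-shift move) ⟩
    r x ℚ.* (level h' ℚ.- level h) ℚ.+ (r y ℚ.* level l ℚ.- r x ℚ.* level h')
                                                           ≡⟨ solve 5 (λ rx ry L H H' → rx :* (H' :- H) :+ (ry :* L :- rx :* H')
                                                                                    := ry :* L :- rx :* H)
                                                                refl (r x) (r y) (level l) (level h) (level h') ⟩
    r y ℚ.* level l ℚ.- r x ℚ.* level h                    ∎
    where
    σ = ℤ→ℚ (shiftℤ s)
    r-x≤r-x' : r x ℚ.* level h' ℚ.≤ r x' ℚ.* level h'
    r-x≤r-x' = ℚP.*-monoʳ-≤-nonNeg (level h') {{ℚ.nonNegative (0≤level h')}} (r-mono (step s w e []))
    open ℚP.≤-Reasoning
    open ℚSolver.+-*-Solver

  weightN-bounded : ∀ {x h y l} (P : PathN M x h y l) →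
                    weightN P ℚ.≤ excess ℚ.+ (r y ℚ.* level l ℚ.- r x ℚ.* level h)
  weightN-bounded P = subst (ℚ._≤ _) (sym (weightN≡weight∘project P))
    (ℚP.≤-trans (weight≤excess+drift (project P)) (ℚP.+-monoʳ-≤ excess (drift∘project≤ P)))

-- Discreteness of the weights

archimedean : ∀ q → q ℚ.< ℤ→ℚ (+ suc ℤ.∣ ℚ.↥ q ∣)
archimedean q@(mkℚ num d _) rewrite ℤ→ℚ≡mkℚ (+ suc ℤ.∣ num ∣) =
  ℚ.*<* (subst₂ ℤ._<_ (sym (ℤP.*-identityʳ num)) (ℤP.pos-* (suc ℤ.∣ num ∣) (suc d))
    (ℤP.≤-<-trans (i≤∣i∣ num) (ℤ.+<+ (ℕP.m≤m*n (suc ℤ.∣ num ∣) (suc d)))))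
  where
  i≤∣i∣ : ∀ i → i ℤ.≤ + ℤ.∣ i ∣
  i≤∣i∣ (+ _)    = ℤP.≤-refl
  i≤∣i∣ -[1+ _ ] = ℤ.-≤+

discrete-increasing⇒unbounded : ∀ (a : ℕ → ℚ) {D} B → 0ℚ ℚ.< D →
  (∀ m → Σ ℤ λ z → a m ℚ.* D ≡ ℤ→ℚ z) → (∀ m → a m ℚ.< a (suc m)) → ¬ (∀ m → a m ℚ.≤ B)
discrete-increasing⇒unbounded a {D} B 0<D integral increasing bounded =
  ℚP.<-irrefl refl (ℚP.≤-<-trans (m≤K (suc ℤ.∣ ℚ.↥ K ∣)) (archimedean K))
  where
  z : ℕ → ℤ
  z m = proj₁ (integral m)

  z-increasing : ∀ m → z m ℤ.< z (suc m)
  z-increasing m = ℤ→ℚ-cancel-< (subst₂ ℚ._<_ (proj₂ (integral m)) (proj₂ (integral (suc m)))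
    (ℚP.*-monoˡ-<-pos D {{ℚ.positive 0<D}} (increasing m)))

  z-growth : ∀ m → z 0 ℤ.+ + m ℤ.≤ z m
  z-growth zero    = ℤP.≤-reflexive (ℤP.+-identityʳ (z 0))
  z-growth (suc m) = ℤP.≤-trans (ℤP.≤-reflexive (solve 2 (λ a b → a :+ (con (+ 1) :+ b) := con (+ 1) :+ (a :+ b)) refl (z 0) (+ m)))
    (ℤP.≤-trans (ℤP.+-monoʳ-≤ (+ 1) (z-growth m)) (ℤP.i<j⇒suc[i]≤j (z-increasing m)))
    where open ℤSolver.+-*-Solver

  K : ℚ
  K = B ℚ.* D ℚ.- ℤ→ℚ (z 0)

  m≤K : ∀ m → ℤ→ℚ (+ m) ℚ.≤ K
  m≤K m = begin
    ℤ→ℚ (+ m)                                   ≡⟨ solve 2 (λ x y → y := (x :+ y) :- x) refl (ℤ→ℚ (z 0)) (ℤ→ℚ (+ m)) ⟩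
    (ℤ→ℚ (z 0) ℚ.+ ℤ→ℚ (+ m)) ℚ.- ℤ→ℚ (z 0)     ≡⟨ cong (ℚ._- ℤ→ℚ (z 0)) (ℤ→ℚ-homo-+ (z 0) (+ m)) ⟨
    ℤ→ℚ (z 0 ℤ.+ + m) ℚ.- ℤ→ℚ (z 0)             ≤⟨ ℚP.+-monoˡ-≤ (ℚ.- ℤ→ℚ (z 0)) (begin
      ℤ→ℚ (z 0 ℤ.+ + m)                             ≤⟨ ℤ→ℚ-mono-≤ (z-growth m) ⟩
      ℤ→ℚ (z m)                                     ≡⟨ proj₂ (integral m) ⟨
      a m ℚ.* D                                     ≤⟨ ℚP.*-monoʳ-≤-nonNeg D {{ℚ.nonNegative (ℚP.<⇒≤ 0<D)}} (bounded m) ⟩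
      B ℚ.* D                                       ∎) ⟩
    K                                           ∎
    where open ℚP.≤-Reasoning
          open ℚSolver.+-*-Solver

scaled-integral : ∀ w c → Σ ℤ λ z → w ℚ.* ℤ→ℚ (+ (c ℕ.* ℚ.↧ₙ w)) ≡ ℤ→ℚ z
scaled-integral w@(mkℚ num d _) c = num ℤ.* + c , ℚP.toℚᵘ-injective
  (ℚᵘP.≃-trans (ℚP.toℚᵘ-homo-* w (ℤ→ℚ (+ (c ℕ.* suc d))))
  (ℚᵘP.≃-trans (ℚᵘP.*-congˡ {ℚᵘ.mkℚᵘ num d} (toℚᵘ-ℤ→ℚ (+ (c ℕ.* suc d))))
  (ℚᵘP.≃-trans (ℚᵘ.*≡* cross) (ℚᵘP.≃-sym (toℚᵘ-ℤ→ℚ (num ℤ.* + c))))))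
  where
  open ℤSolver.+-*-Solver
  cross : (num ℤ.* + (c ℕ.* suc d)) ℤ.* + 1 ≡ (num ℤ.* + c) ℤ.* + suc (d ℕ.* 1)
  cross = begin
    (num ℤ.* + (c ℕ.* suc d)) ℤ.* + 1     ≡⟨ cong (λ t → (num ℤ.* t) ℤ.* + 1) (ℤP.pos-* c (suc d)) ⟩
    (num ℤ.* (+ c ℤ.* + suc d)) ℤ.* + 1   ≡⟨ solve 3 (λ a c e → (a :* (c :* e)) :* con (+ 1) := (a :* c) :* e) refl num (+ c) (+ suc d) ⟩
    (num ℤ.* + c) ℤ.* + suc d             ≡⟨ cong (λ t → (num ℤ.* + c) ℤ.* + suc t) (ℕP.*-identityʳ d) ⟨
    (num ℤ.* + c) ℤ.* + suc (d ℕ.* 1)     ∎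
    where open ≡-Reasoning

module Discreteness {n : ℕ} (M : Mats n) where

  arcWeightsFrom : Shift → Fin n → List ℚ
  arcWeightsFrom s i = concatMap (λ j → fromMaybe (M s j i)) (allFin n)

  arcWeights : List ℚ
  arcWeights = concatMap (λ s → concatMap (arcWeightsFrom s) (allFin n)) shifts

  ∈-arcWeights : ∀ {s j i w} → M s j i ≡ just w → w ∈ arcWeights
  ∈-arcWeights {s} {j} {i} {w} e =
    ∈-concatMap⁺′ {f = λ s → concatMap (arcWeightsFrom s) (allFin n)} (∈-shifts s)
      (∈-concatMap⁺′ {f = arcWeightsFrom s} (∈P.∈-allFin i)
        (∈-concatMap⁺′ {f = λ j → fromMaybe (M s j i)} (∈P.∈-allFin j)
          (subst (λ m → w ∈ fromMaybe m) (sym e) (Any.here refl))))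

  opaque
    denominator : ℕ
    denominator = product (map ℚ.↧ₙ_ arcWeights)

    scale : ℚ
    scale = ℤ→ℚ (+ denominator)

    0<scale : 0ℚ ℚ.< scale
    0<scale = ℤ→ℚ-mono-< {+ 0} {+ denominator} (ℤ.+<+ (ℕ.>-nonZero⁻¹ denominator
      {{product≢0 (All.map⁺ (All.universal (λ _ → _) arcWeights))}}))

    arc-integral : ∀ {s j i w} → M s j i ≡ just w → Σ ℤ λ z → w ℚ.* scale ≡ ℤ→ℚ z
    arc-integral {w = w} e with divides c denominator≡ ← ∈⇒∣product (∈P.∈-map⁺ ℚ.↧ₙ_ (∈-arcWeights e)) =
      subst (λ m → Σ ℤ λ z → w ℚ.* ℤ→ℚ (+ m) ≡ ℤ→ℚ z) (sym denominator≡) (scaled-integral w c)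

  weight-integral : ∀ {x y} (q : Path M x y) → Σ ℤ λ z → weight q ℚ.* scale ≡ ℤ→ℚ z
  weight-integral []               = + 0 , ℚP.*-zeroˡ scale
  weight-integral (step s w e q)
    with z₁ , w≡ ← arc-integral e | z₂ , q≡ ← weight-integral q =
    z₁ ℤ.+ z₂ , trans (ℚP.*-distribʳ-+ scale w (weight q)) (trans (cong₂ ℚ._+_ w≡ q≡) (sym (ℤ→ℚ-homo-+ z₁ z₂)))

neither⇒¬HasInfWeightPath : ∀ {n} (M : Mats n) → ¬ CondI M → ¬ CondII M → ¬ HasInfWeightPath M
neither⇒¬HasInfWeightPath M ¬I ¬II (i , k , j , l , _ , _ , p , increasing) =
  discrete-increasing⇒unbounded (λ m → weightN (p m)) _ 0<scale integral increasing
    (λ m → weightN-bounded (p m))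
  where
  open Potential M ¬I ¬II
  open Discreteness M
  integral : ∀ m → Σ ℤ λ z → weightN (p m) ℚ.* scale ≡ ℤ→ℚ z
  integral m = subst (λ w → Σ ℤ λ z → w ℚ.* scale ≡ ℤ→ℚ z) (sym (weightN≡weight∘project (p m)))
                 (weight-integral (project (p m)))

mainTheorem2 : (n : ℕ) (M : Mats n) →
    HasInfWeightPath M ⇔ (CondI M ⊎ CondII M)
mainTheorem2 n M = mk⇔ necessary [ CondI⇒HasInfWeightPath , CondII⇒HasInfWeightPath ]′
  where
  necessary : HasInfWeightPath M → CondI M ⊎ CondII M
  necessary inf with condI? M | condII? M
  ... | yes I  | _       = inj₁ I
  ... | no _   | yes II  = inj₂ II
  ... | no ¬I  | no ¬II  = ⊥-elim (neither⇒¬HasInfWeightPath M ¬I ¬II inf)
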